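{- Let $n\ge 2$ and let $A\in M$ be a solution of multiplicity $1$ and degree $k$ with $k\ge\lceil n/2\rceil+1$. Then the $G$-orbit of $A$ contains no element of multiplicity $1$ other than $A$. Furthermore, $G$ acts faithfully on the orbit of $A$, so this orbit contains exactly $\phi(n)$ elements.
   Context: Let $\mathbb{N}=\{0,1,2,\ldots\}$ and $M=\{(a_1,\ldots,a_{n-1})\in\mathbb{N}^{n-1} : a_1+2a_2+\cdots+(n-1)a_{n-1}\equiv 0 \pmod n\}$. For $A\in M$, $\deg(A)=a_1+\cdots+a_{n-1}$ and the multiplicity is $m(A)=(a_1+2a_2+\cdots+(n-1)a_{n-1})/n$. Let $G=\mathrm{Aut}(\mathbb{Z}/n\mathbb{Z})$, represented by the integers $1\le g\le n-1$ with $\gcd(g,n)=1$, so $|G|=\phi(n)$ (Euler's totient). For such $g$ let $\sigma_g$ be the permutation of $\{1,\ldots,n-1\}$ with $\sigma_g(i)\equiv gi\pmod n$, and $g\cdot A=(a_{\sigma_g^{ -1}(1)},\ldots,a_{\sigma_g^{ -1}(n-1)})$; this defines an action of $G$ on $M$. Here $\lceil n/2\rceil=n-\lfloor n/2\rfloor$. -}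

module Defs where

open import Data.Nat using (ℕ; zero; suc; _+_; _*_; _∸_; _≤_; NonZero; _≡ᵇ_)
open import Data.Nat.DivMod using (_/_; _%_)
open import Data.Nat.Coprimality using (Coprime)
open import Data.Fin using (Fin; toℕ)
open import Data.Vec using (Vec; lookup; tabulate; sum; allFin; toList)
open import Data.List using (List; []; _∷_)
open import Data.Bool using (Bool; if_then_else_)
open import Data.Product using (_×_)
open import Relation.Binary.PropositionalEquality using (_≡_)

-- A vector A : Vec ℕ (n ∸ 1) represents (a_1,…,a_{n-1});
-- position i : Fin (n ∸ 1) stores a_{i+1}.

weight : ∀ {k} → Vec ℕ k → ℕ
weight A = sum (tabulate (λ i → suc (toℕ i) * lookup A i))

deg : ∀ {k} → Vec ℕ k → ℕ
deg A = sum A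

InM : (n : ℕ) .{{_ : NonZero n}} → Vec ℕ (n ∸ 1) → Set
InM n A = weight A % n ≡ 0

mult : (n : ℕ) .{{_ : NonZero n}} → Vec ℕ (n ∸ 1) → ℕ
mult n A = weight A / n

-- g represents an element of G = Aut(ℤ/nℤ): 1 ≤ g ≤ n-1, gcd(g,n)=1
IsUnit : ℕ → ℕ → Set
IsUnit n g = 1 ≤ g × g ≤ n ∸ 1 × Coprime g n

findOr : ∀ {k} → Fin k → (Fin k → Bool) → List (Fin k) → Fin k
findOr d p [] = d
findOr d p (x ∷ xs) = if p x then x else findOr d p xs

-- σ_g⁻¹(j): the (unique, for g coprime to n) index i ∈ {1,…,n-1}
-- with g·i ≡ j (mod n); positions are shifted by one (Fin index t ↔ t+1).
σinv : (n : ℕ) .{{_ : NonZero n}} → ℕ → Fin (n ∸ 1) → Fin (n ∸ 1)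
σinv n g j = findOr j (λ i → ((g * suc (toℕ i)) % n) ≡ᵇ (suc (toℕ j) % n))
                      (toList (allFin (n ∸ 1)))

act : (n : ℕ) .{{_ : NonZero n}} → ℕ → Vec ℕ (n ∸ 1) → Vec ℕ (n ∸ 1)
act n g A = tabulate (λ j → lookup A (σinv n g j))

{-# OPTIONS --safe #-}
-- Let a have weight ∑ i a_i = n and degree k with 2k ≥ n + 2, and let u be a unit.  The action
-- preserves M, and reindexing shows that u·a has weight ∑ c_i a_i with c_i = u i mod n.  If that
-- weight is n as well, the weightings i ↦ i and i ↦ c_i each take the value 1 exactly once (at 1
-- and at p ≡ u⁻¹) and are ≥ 2 elsewhere.  Then a_1, a_p ≥ 2, and comparing ∑ (i + c_i) a_i = 2n
-- with 4k shows that c_1 = u or p equals 2, whence u p ≤ n.  As u p ≡ 1 (mod n), this forces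
-- p = 1, i.e. u = 1.  Faithfulness follows by applying this to h⁻¹ g whenever g·a = h·a.
module Submission where

open import Defs
open import Data.Nat using (ℕ; zero; suc; _≡ᵇ_; _+_; _*_; _∸_; _≤_; _<_; z≤n; s≤s; s≤s⁻¹; NonZero; ≢-nonZero; ⌈_/2⌉; ⌊_/2⌋)
open import Data.Nat.Properties hiding (_≟_)
open import Data.Nat.DivMod
open import Data.Nat.Coprimality using (Coprime; coprime-Bézout)
open import Data.Nat.GCD using (module Bézout)
open import Data.Nat.Tactic.RingSolver using (solve-∀)
open import Algebra.Properties.Semiring.Sum +-*-semiring using (sum; sum-remove; sum-permute; sum-cong-≗; ∑-distrib-+; *-distribˡ-sum)
open import Data.Fin using (Fin; zero; suc; toℕ; fromℕ<; punchIn; _≟_)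
open import Data.Fin.Properties using (toℕ-injective; toℕ-fromℕ<; toℕ<n; punchInᵢ≢i)
open import Data.Fin.Permutation using (Permutation; permutation)
open import Data.Vec using (Vec; lookup; tabulate)
import Data.Vec as Vec
open import Data.Vec.Properties using (lookup∘tabulate; tabulate∘lookup; tabulate-cong)
open import Data.Vec.Membership.Propositional.Properties using (∈-allFin⁺; ∈-toList⁺)
open import Data.List using (List; _∷_)
open import Data.List.Membership.Propositional using (_∈_)
open import Data.List.Relation.Unary.Any using (here; there)
open import Data.Bool using (Bool; true; false; T)
open import Data.Product using (_×_; _,_; proj₁; proj₂)
open import Data.Sum using (inj₁; inj₂)
open import Function using (_∘_)
open import Relation.Nullary using (yes; no; contradiction)
open import Relation.Binary.PropositionalEquality

sum-tabulate : ∀ {k} (f : Fin k → ℕ) → Vec.sum (tabulate f) ≡ sum f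
sum-tabulate {zero} f = refl
sum-tabulate {suc k} f = cong (f zero +_) (sum-tabulate (f ∘ suc))

sum-mono-≤ : ∀ {k} {f g : Fin k → ℕ} → (∀ i → f i ≤ g i) → sum f ≤ sum g
sum-mono-≤ {zero} f≤g = z≤n
sum-mono-≤ {suc k} f≤g = +-mono-≤ (f≤g zero) (sum-mono-≤ (f≤g ∘ suc))

term≤sum : ∀ {k} (f : Fin k → ℕ) i → f i ≤ sum f
term≤sum {suc k} f i = ≤-trans (m≤m+n (f i) _) (≤-reflexive (sym (sum-remove {i = i} f)))

infix 8 _·_

_·_ : ∀ {k} → (Fin k → ℕ) → (Fin k → ℕ) → ℕ
w · a = sum (λ i → w i * a i)

*sum≤· : ∀ {k} {b} {w : Fin k → ℕ} → (∀ i → b ≤ w i) → (a : Fin k → ℕ) → b * sum a ≤ w · a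
*sum≤· {b = b} {w} b≤w a = begin
  b * sum a             ≡⟨ *-distribˡ-sum b a ⟩
  sum (λ i → b * a i)   ≤⟨ sum-mono-≤ (λ i → *-monoˡ-≤ (a i) (b≤w i)) ⟩
  w · a                 ∎
  where open ≤-Reasoning

·-distribʳ-+ : ∀ {k} (v c a : Fin k → ℕ) → (λ i → v i + c i) · a ≡ v · a + c · a
·-distribʳ-+ v c a = trans (sum-cong-≗ (λ i → *-distribʳ-+ (a i) (v i) (c i)))
                           (∑-distrib-+ (λ i → v i * a i) (λ i → c i * a i))

*-·-assoc : ∀ {k} u (x a : Fin k → ℕ) → (λ i → u * x i) · a ≡ u * (x · a)
*-·-assoc u x a = trans (sum-cong-≗ (λ i → *-assoc u (x i) (a i)))
                        (sym (*-distribˡ-sum u (λ i → x i * a i)))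

OneOnlyAt : ∀ {k} → (Fin k → ℕ) → Fin k → Set
OneOnlyAt w p = w p ≡ 1 × (∀ i → i ≢ p → 2 ≤ w i)

oneOnlyAt⇒2∑≤·+ : ∀ {k} {w : Fin k → ℕ} {p} → OneOnlyAt w p →
  (a : Fin k → ℕ) → 2 * sum a ≤ w · a + a p
oneOnlyAt⇒2∑≤·+ {suc k} {w} {p} (wp≡1 , w≥2) a = begin
  2 * sum a                          ≡⟨ cong (2 *_) (sum-remove {i = p} a) ⟩
  2 * (a p + sum (a ∘ punchIn p))    ≡⟨ *-distribˡ-+ 2 (a p) _ ⟩
  2 * a p + 2 * sum (a ∘ punchIn p)  ≤⟨ +-monoʳ-≤ (2 * a p) (*sum≤· (λ i → w≥2 _ (punchInᵢ≢i p i)) (a ∘ punchIn p)) ⟩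
  2 * a p + rest                     ≡⟨ regroup (a p) rest ⟩
  1 * a p + rest + a p               ≡⟨ cong (λ c → c * a p + rest + a p) wp≡1 ⟨
  w p * a p + rest + a p             ≡⟨ cong (_+ a p) (sum-remove {i = p} (λ i → w i * a i)) ⟨
  w · a + a p                        ∎
  where
  open ≤-Reasoning
  rest : ℕ
  rest = (w ∘ punchIn p) · (a ∘ punchIn p)
  regroup : ∀ x r → 2 * x + r ≡ 1 * x + r + x
  regroup = solve-∀

oneOnlyAt⇒2≤ : ∀ {k} {w : Fin k → ℕ} {p} {N} → OneOnlyAt w p → (a : Fin k → ℕ) →
  w · a ≤ N → N + 2 ≤ 2 * sum a → 2 ≤ a p
oneOnlyAt⇒2≤ {w = w} {p} {N} w-one a wa≤N N+2≤2∑a = +-cancelˡ-≤ N 2 (a p) (begin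
  N + 2       ≤⟨ N+2≤2∑a ⟩
  2 * sum a   ≤⟨ oneOnlyAt⇒2∑≤·+ w-one a ⟩
  w · a + a p ≤⟨ +-monoˡ-≤ (a p) wa≤N ⟩
  N + a p     ∎)
  where open ≤-Reasoning

-- Unless c z or v p equals 2, every i has v i + c i ≥ 4, and then 4 ∑ a ≤ 2 N < 4 ∑ a.
oneOnlyAt-cross≤ : ∀ {k} {v c : Fin k → ℕ} {z p} {N} → OneOnlyAt v z → OneOnlyAt c p → z ≢ p →
  (a : Fin k → ℕ) → v · a ≤ N → c · a ≤ N → N + 2 ≤ 2 * sum a → c z * v p ≤ N
oneOnlyAt-cross≤ {v = v} {c} {z} {p} {N} v-one c-one z≢p a va≤N ca≤N N+2≤2∑a
  with m≤n⇒m<n∨m≡n (proj₂ c-one z z≢p) | m≤n⇒m<n∨m≡n (proj₂ v-one p (z≢p ∘ sym))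
... | inj₂ 2≡cz | _ = begin
  c z * v p ≡⟨ cong (_* v p) 2≡cz ⟨
  2 * v p   ≤⟨ *-monoˡ-≤ (v p) (oneOnlyAt⇒2≤ c-one a ca≤N N+2≤2∑a) ⟩
  a p * v p ≡⟨ *-comm (a p) (v p) ⟩
  v p * a p ≤⟨ term≤sum (λ i → v i * a i) p ⟩
  v · a     ≤⟨ va≤N ⟩
  N         ∎
  where open ≤-Reasoning
... | _ | inj₂ 2≡vp = begin
  c z * v p ≡⟨ cong (c z *_) 2≡vp ⟨
  c z * 2   ≤⟨ *-monoʳ-≤ (c z) (oneOnlyAt⇒2≤ v-one a va≤N N+2≤2∑a) ⟩
  c z * a z ≤⟨ term≤sum (λ i → c i * a i) z ⟩
  c · a     ≤⟨ ca≤N ⟩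
  N         ∎
  where open ≤-Reasoning
... | inj₁ 3≤cz | inj₁ 3≤vp = contradiction (begin
  N + N + 4                   ≡⟨ double N ⟩
  2 * (N + 2)                 ≤⟨ *-monoʳ-≤ 2 N+2≤2∑a ⟩
  2 * (2 * sum a)             ≡⟨ *-assoc 2 2 (sum a) ⟨
  4 * sum a                   ≤⟨ *sum≤· 4≤v+c a ⟩
  (λ i → v i + c i) · a       ≡⟨ ·-distribʳ-+ v c a ⟩
  v · a + c · a               ≤⟨ +-mono-≤ va≤N ca≤N ⟩
  N + N                       ∎) (m+1+n≰m (N + N))
  where
  open ≤-Reasoning
  double : ∀ m → m + m + 4 ≡ 2 * (m + 2)
  double = solve-∀
  4≤v+c : ∀ i → 4 ≤ v i + c i
  4≤v+c i with i ≟ z | i ≟ p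
  ... | yes refl | _ = subst (λ x → 4 ≤ x + c i) (sym (proj₁ v-one)) (s≤s 3≤cz)
  ... | no _ | yes refl = subst (λ x → 4 ≤ v i + x) (sym (proj₁ c-one)) (subst (4 ≤_) (+-comm 1 (v i)) (s≤s 3≤vp))
  ... | no i≢z | no i≢p = +-mono-≤ (proj₂ v-one i i≢z) (proj₂ c-one i i≢p)

⌈n/2⌉<k⇒n+2≤2k : ∀ n k → suc ⌈ n /2⌉ ≤ k → n + 2 ≤ 2 * k
⌈n/2⌉<k⇒n+2≤2k n k ⌈n/2⌉<k = begin
  n + 2                     ≡⟨ cong (_+ 2) (⌊n/2⌋+⌈n/2⌉≡n n) ⟨
  ⌊ n /2⌋ + ⌈ n /2⌉ + 2     ≤⟨ +-monoˡ-≤ 2 (+-monoˡ-≤ ⌈ n /2⌉ (⌊n/2⌋≤⌈n/2⌉ n)) ⟩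
  ⌈ n /2⌉ + ⌈ n /2⌉ + 2     ≡⟨ regroup ⌈ n /2⌉ ⟩
  2 * suc ⌈ n /2⌉           ≤⟨ *-monoʳ-≤ 2 ⌈n/2⌉<k ⟩
  2 * k                     ∎
  where
  open ≤-Reasoning
  regroup : ∀ m → m + m + 2 ≡ 2 * suc m
  regroup = solve-∀

module Modulo (d : ℕ) .{{_ : NonZero d}} where

  m*[n%d]%d≡m*n%d : ∀ m n → m * (n % d) % d ≡ m * n % d
  m*[n%d]%d≡m*n%d m n = begin
    m * (n % d) % d           ≡⟨ %-distribˡ-* m (n % d) d ⟩
    (m % d) * (n % d % d) % d ≡⟨ cong (λ r → (m % d) * r % d) (m%n%n≡m%n n d) ⟩
    (m % d) * (n % d) % d     ≡⟨ %-distribˡ-* m n d ⟨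
    m * n % d                 ∎
    where open ≡-Reasoning

  [m%d]*n%d≡m*n%d : ∀ m n → (m % d) * n % d ≡ m * n % d
  [m%d]*n%d≡m*n%d m n = begin
    (m % d) * n % d ≡⟨ cong (_% d) (*-comm (m % d) n) ⟩
    n * (m % d) % d ≡⟨ m*[n%d]%d≡m*n%d n m ⟩
    n * m % d       ≡⟨ cong (_% d) (*-comm n m) ⟩
    m * n % d       ∎
    where open ≡-Reasoning

  [x%d]·a%d≡x·a%d : ∀ {k} (x a : Fin k → ℕ) → (λ i → x i % d) · a % d ≡ x · a % d
  [x%d]·a%d≡x·a%d {zero} x a = refl
  [x%d]·a%d≡x·a%d {suc k} x a = begin
    (x zero % d * a zero + rest%) % d                ≡⟨ %-distribˡ-+ (x zero % d * a zero) rest% d ⟩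
    ((x zero % d * a zero) % d + rest% % d) % d      ≡⟨ cong₂ (λ r s → (r + s) % d) ([m%d]*n%d≡m*n%d (x zero) (a zero)) ([x%d]·a%d≡x·a%d (x ∘ suc) (a ∘ suc)) ⟩
    ((x zero * a zero) % d + rest % d) % d           ≡⟨ %-distribˡ-+ (x zero * a zero) rest d ⟨
    (x zero * a zero + rest) % d                     ∎
    where
    open ≡-Reasoning
    rest% rest : ℕ
    rest% = (λ i → x (suc i) % d) · (a ∘ suc)
    rest = (x ∘ suc) · (a ∘ suc)

  m%d≡0∧m/d≡1⇒m≡d : ∀ {m} → m % d ≡ 0 → m / d ≡ 1 → m ≡ d
  m%d≡0∧m/d≡1⇒m≡d {m} m%d≡0 m/d≡1 = begin
    m                 ≡⟨ m≡m%n+[m/n]*n m d ⟩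
    m % d + m / d * d ≡⟨ cong₂ (λ r q → r + q * d) m%d≡0 m/d≡1 ⟩
    1 * d             ≡⟨ *-identityˡ d ⟩
    d                 ∎
    where open ≡-Reasoning

  m%d≡1⇒d<m : ∀ {m} → m % d ≡ 1 → 2 ≤ m → d < m
  m%d≡1⇒d<m {m} m%d≡1 2≤m = ≤∧≢⇒< d≤m d≢m
    where
    d≤m : d ≤ m
    d≤m = m/n≢0⇒n≤m λ m/d≡0 →
      1+n≰n (subst (2 ≤_) (trans (sym (m<n⇒m%n≡m (m/n≡0⇒m<n m/d≡0))) m%d≡1) 2≤m)
    d≢m : d ≢ m
    d≢m refl = 0≢1+n (trans (sym (n%n≡0 d)) m%d≡1)

  record Invertible (u : ℕ) : Set where
    constructor invertible
    field
      inv     : ℕ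
      inv*u≡1 : inv * u % d ≡ 1 % d

  inverse-cancels : ∀ {u} → ((invertible w _) : Invertible u) → ∀ x → w * (u * x) % d ≡ x % d
  inverse-cancels {u} (invertible w wu≡1) x = begin
    w * (u * x) % d               ≡⟨ cong (_% d) (*-assoc w u x) ⟨
    (w * u) * x % d               ≡⟨ [m%d]*n%d≡m*n%d (w * u) x ⟨
    (w * u % d) * x % d           ≡⟨ cong (λ r → r * x % d) wu≡1 ⟩
    (1 % d) * x % d               ≡⟨ [m%d]*n%d≡m*n%d 1 x ⟩
    1 * x % d                     ≡⟨ cong (_% d) (*-identityˡ x) ⟩
    x % d                         ∎
    where open ≡-Reasoning

  inverse-invertible : ∀ {u} → ((invertible w _) : Invertible u) → Invertible w
  inverse-invertible {u} (invertible w wu≡1) = invertible u (trans (cong (_% d) (*-comm u w)) wu≡1)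

  invertible-cancelˡ : ∀ {u x y} → Invertible u → u * x % d ≡ u * y % d → x % d ≡ y % d
  invertible-cancelˡ {u} {x} {y} u⁻¹@(invertible w _) ux≡uy = begin
    x % d               ≡⟨ inverse-cancels u⁻¹ x ⟨
    w * (u * x) % d     ≡⟨ m*[n%d]%d≡m*n%d w (u * x) ⟨
    w * (u * x % d) % d ≡⟨ cong (λ r → w * r % d) ux≡uy ⟩
    w * (u * y % d) % d ≡⟨ m*[n%d]%d≡m*n%d w (u * y) ⟩
    w * (u * y) % d     ≡⟨ inverse-cancels u⁻¹ y ⟩
    y % d               ∎
    where open ≡-Reasoning

  invertible-* : ∀ {u v} → Invertible u → Invertible v → Invertible (u * v)
  invertible-* {u} {v} u⁻¹@(invertible w _) (invertible w′ w′v≡1) = invertible (w′ * w) (begin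
    w′ * w * (u * v) % d       ≡⟨ cong (_% d) (*-assoc w′ w (u * v)) ⟩
    w′ * (w * (u * v)) % d     ≡⟨ m*[n%d]%d≡m*n%d w′ (w * (u * v)) ⟨
    w′ * (w * (u * v) % d) % d ≡⟨ cong (λ r → w′ * r % d) (inverse-cancels u⁻¹ v) ⟩
    w′ * (v % d) % d           ≡⟨ m*[n%d]%d≡m*n%d w′ v ⟩
    w′ * v % d                 ≡⟨ w′v≡1 ⟩
    1 % d                      ∎)
    where open ≡-Reasoning

-- In the second Bézout case x * u ≡ -1 (mod suc m), so x * m is an inverse.
coprime⇒invertible : ∀ {u m} → Coprime u (suc m) → Modulo.Invertible (suc m) u
coprime⇒invertible {u} {m} u⊥N with coprime-Bézout u⊥N
... | Bézout.+- x y 1+yN≡xu = Modulo.invertible x (begin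
  x * u % suc m             ≡⟨ cong (_% suc m) 1+yN≡xu ⟨
  (1 + y * suc m) % suc m   ≡⟨ [m+kn]%n≡m%n 1 y (suc m) ⟩
  1 % suc m                 ∎)
  where open ≡-Reasoning
... | Bézout.-+ x y 1+xu≡yN = Modulo.invertible (x * m) (begin
  x * m * u % suc m                   ≡⟨ [m+kn]%n≡m%n (x * m * u) y (suc m) ⟨
  (x * m * u + y * suc m) % suc m     ≡⟨ cong (λ r → (x * m * u + r) % suc m) 1+xu≡yN ⟨
  (x * m * u + (1 + x * u)) % suc m   ≡⟨ cong (_% suc m) (regroup x m u) ⟩
  (1 + x * u * suc m) % suc m         ≡⟨ [m+kn]%n≡m%n 1 (x * u) (suc m) ⟩
  1 % suc m                           ∎)
  where
  open ≡-Reasoning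
  regroup : ∀ x m u → x * m * u + (1 + x * u) ≡ 1 + x * u * suc m
  regroup = solve-∀

findOr-unique : ∀ {k} {d : Fin k} {p : Fin k → Bool} {xs : List (Fin k)} {x} →
  x ∈ xs → T (p x) → (∀ y → T (p y) → y ≡ x) → findOr d p xs ≡ x
findOr-unique {p = p} {y ∷ xs} x∈ px unique with p y in py
... | true = unique y (subst T (sym py) _)
findOr-unique {p = p} {y ∷ xs} (here refl) px unique | false = contradiction (subst T py px) λ ()
findOr-unique {p = p} {y ∷ xs} (there x∈xs) px unique | false = findOr-unique x∈xs px unique

module Action (t : ℕ) where

  N : ℕ
  N = suc (suc t)

  open Modulo N

  pos : Fin (suc t) → ℕ
  pos i = suc (toℕ i)

  pos%N : ∀ i → pos i % N ≡ pos i
  pos%N i = m<n⇒m%n≡m (s≤s (toℕ<n i))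

  pos-injective : ∀ {i j} → pos i ≡ pos j → i ≡ j
  pos-injective = toℕ-injective ∘ suc-injective

  pos≥2 : ∀ {j} → j ≢ zero → 2 ≤ pos j
  pos≥2 {zero} j≢0 = contradiction refl j≢0
  pos≥2 {suc j} _ = s≤s (s≤s z≤n)

  pos-oneOnlyAt : OneOnlyAt pos zero
  pos-oneOnlyAt = refl , λ _ → pos≥2

  -- The residue u * pos i % N as a position; `pred` would send the residue 0 to position 0,
  -- which never occurs for invertible u (pos-scale).
  scale : ℕ → Fin (suc t) → Fin (suc t)
  scale u i = fromℕ< (s≤s (pred-mono-≤ (s≤s⁻¹ (m%n<n (u * pos i) N))))

  pos-scale : ∀ {u} → Invertible u → ∀ i → pos (scale u i) ≡ u * pos i % N
  pos-scale {u} u⁻¹ i = trans (cong suc (toℕ-fromℕ< _)) (suc-pred (u * pos i % N) {{≢-nonZero ui≢0}})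
    where
    ui≢0 : u * pos i % N ≢ 0
    ui≢0 ui≡0 = 1+n≢0 (trans (sym (pos%N i))
                  (invertible-cancelˡ u⁻¹ (trans ui≡0 (cong (_% N) (sym (*-zeroʳ u))))))

  σinv-unique : ∀ {u} → Invertible u → ∀ {i j} → u * pos i % N ≡ pos j → σinv N u j ≡ i
  σinv-unique {u} u⁻¹ {i} {j} ui≡j =
    findOr-unique (∈-toList⁺ (∈-allFin⁺ i)) (≡⇒≡ᵇ _ _ (trans ui≡j (sym (pos%N j)))) unique
    where
    unique : ∀ y → T (u * pos y % N ≡ᵇ pos j % N) → y ≡ i
    unique y uy≡j = pos-injective (begin
      pos y     ≡⟨ pos%N y ⟨
      pos y % N ≡⟨ invertible-cancelˡ u⁻¹ (trans (≡ᵇ⇒≡ _ _ uy≡j) (trans (pos%N j) (sym ui≡j))) ⟩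
      pos i % N ≡⟨ pos%N i ⟩
      pos i     ∎)
      where open ≡-Reasoning

  σinv-scale : ∀ {u} → Invertible u → ∀ i → σinv N u (scale u i) ≡ i
  σinv-scale u⁻¹ i = σinv-unique u⁻¹ (sym (pos-scale u⁻¹ i))

  pos-σinv : ∀ {u} → Invertible u → ∀ j → u * pos (σinv N u j) % N ≡ pos j
  pos-σinv {u} u⁻¹@(invertible w _) j = begin
    u * pos (σinv N u j) % N ≡⟨ cong (λ i → u * pos i % N) (σinv-unique u⁻¹ u[w*j]≡j) ⟩
    u * pos (scale w j) % N  ≡⟨ u[w*j]≡j ⟩
    pos j                    ∎
    where
    open ≡-Reasoning
    u[w*j]≡j : u * pos (scale w j) % N ≡ pos j
    u[w*j]≡j = begin
      u * pos (scale w j) % N ≡⟨ cong (λ r → u * r % N) (pos-scale (inverse-invertible u⁻¹) j) ⟩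
      u * (w * pos j % N) % N ≡⟨ m*[n%d]%d≡m*n%d u (w * pos j) ⟩
      u * (w * pos j) % N     ≡⟨ inverse-cancels (inverse-invertible u⁻¹) (pos j) ⟩
      pos j % N               ≡⟨ pos%N j ⟩
      pos j                   ∎

  scale-σinv : ∀ {u} → Invertible u → ∀ j → scale u (σinv N u j) ≡ j
  scale-σinv u⁻¹ j = pos-injective (trans (pos-scale u⁻¹ _) (pos-σinv u⁻¹ j))

  scale-permutation : ∀ {u} → Invertible u → Permutation (suc t) (suc t)
  scale-permutation {u} u⁻¹ = permutation (scale u) (σinv N u) (scale-σinv u⁻¹) (σinv-scale u⁻¹)

  weight≡pos·lookup : (A : Vec ℕ (suc t)) → weight A ≡ pos · lookup A
  weight≡pos·lookup A = sum-tabulate (λ i → pos i * lookup A i)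

  deg≡sum-lookup : (A : Vec ℕ (suc t)) → deg A ≡ sum (lookup A)
  deg≡sum-lookup A = trans (cong Vec.sum (sym (tabulate∘lookup A))) (sum-tabulate (lookup A))

  lookup-act : ∀ u (A : Vec ℕ (suc t)) j → lookup (act N u A) j ≡ lookup A (σinv N u j)
  lookup-act u A = lookup∘tabulate (λ j → lookup A (σinv N u j))

  weight-act : ∀ {u} → Invertible u → (A : Vec ℕ (suc t)) →
    weight (act N u A) ≡ (λ i → u * pos i % N) · lookup A
  weight-act {u} u⁻¹ A = begin
    weight (act N u A)                        ≡⟨ weight≡pos·lookup (act N u A) ⟩
    pos · lookup (act N u A)                  ≡⟨ sum-cong-≗ (λ j → cong (pos j *_) (lookup-act u A j)) ⟩
    sum (λ j → pos j * lookup A (σinv N u j)) ≡⟨ sum-permute (λ j → pos j * lookup A (σinv N u j)) (scale-permutation u⁻¹) ⟩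
    sum (λ i → pos (scale u i) * lookup A (σinv N u (scale u i)))
      ≡⟨ sum-cong-≗ (λ i → cong₂ (λ r k → r * lookup A k) (pos-scale u⁻¹ i) (σinv-scale u⁻¹ i)) ⟩
    (λ i → u * pos i % N) · lookup A          ∎
    where open ≡-Reasoning

  act-InM : ∀ {u} → Invertible u → (A : Vec ℕ (suc t)) → InM N A → InM N (act N u A)
  act-InM {u} u⁻¹ A A∈M = begin
    weight (act N u A) % N               ≡⟨ cong (_% N) (weight-act u⁻¹ A) ⟩
    (λ i → u * pos i % N) · lookup A % N ≡⟨ [x%d]·a%d≡x·a%d (λ i → u * pos i) (lookup A) ⟩
    (λ i → u * pos i) · lookup A % N     ≡⟨ cong (_% N) (*-·-assoc u pos (lookup A)) ⟩
    u * (pos · lookup A) % N             ≡⟨ cong (λ r → u * r % N) (weight≡pos·lookup A) ⟨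
    u * weight A % N                     ≡⟨ m*[n%d]%d≡m*n%d u (weight A) ⟨
    u * (weight A % N) % N               ≡⟨ cong (λ r → u * r % N) A∈M ⟩
    u * 0 % N                            ≡⟨ cong (_% N) (*-zeroʳ u) ⟩
    0                                    ∎
    where open ≡-Reasoning

  act-∘ : ∀ {u w} → Invertible u → Invertible w → (A : Vec ℕ (suc t)) →
    act N u (act N w A) ≡ act N (u * w) A
  act-∘ {u} {w} u⁻¹ w⁻¹ A = tabulate-cong λ j → begin
    lookup (act N w A) (σinv N u j)  ≡⟨ lookup-act w A (σinv N u j) ⟩
    lookup A (σinv N w (σinv N u j)) ≡⟨ cong (lookup A) (σinv-unique (invertible-* u⁻¹ w⁻¹) (uw-σσ j)) ⟨
    lookup A (σinv N (u * w) j)      ∎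
    where
    open ≡-Reasoning
    uw-σσ : ∀ j → u * w * pos (σinv N w (σinv N u j)) % N ≡ pos j
    uw-σσ j = begin
      u * w * pos i % N        ≡⟨ cong (_% N) (*-assoc u w (pos i)) ⟩
      u * (w * pos i) % N      ≡⟨ m*[n%d]%d≡m*n%d u (w * pos i) ⟨
      u * (w * pos i % N) % N  ≡⟨ cong (λ r → u * r % N) (pos-σinv w⁻¹ (σinv N u j)) ⟩
      u * pos (σinv N u j) % N ≡⟨ pos-σinv u⁻¹ j ⟩
      pos j                    ∎
      where
      i : Fin (suc t)
      i = σinv N w (σinv N u j)

  act-identity : ∀ u → u % N ≡ 1 → (A : Vec ℕ (suc t)) → act N u A ≡ A
  act-identity u u≡1 A =
    trans (tabulate-cong λ j → cong (lookup A) (σinv-unique u⁻¹ (u*j≡j j))) (tabulate∘lookup A)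
    where
    open ≡-Reasoning
    u⁻¹ : Invertible u
    u⁻¹ = invertible 1 (trans (cong (_% N) (*-identityˡ u)) u≡1)
    u*j≡j : ∀ j → u * pos j % N ≡ pos j
    u*j≡j j = begin
      u * pos j % N       ≡⟨ [m%d]*n%d≡m*n%d u (pos j) ⟨
      (u % N) * pos j % N ≡⟨ cong (λ r → r * pos j % N) u≡1 ⟩
      1 * pos j % N       ≡⟨ cong (_% N) (*-identityˡ (pos j)) ⟩
      pos j % N           ≡⟨ pos%N j ⟩
      pos j               ∎

  weight-act≡N⇒u≡1 : ∀ {u} → Invertible u → (A : Vec ℕ (suc t)) → weight A ≡ N → N + 2 ≤ 2 * deg A →
    weight (act N u A) ≡ N → u % N ≡ 1
  weight-act≡N⇒u≡1 {u} u⁻¹ A wA≡N N+2≤2k wuA≡N with σinv N u zero ≟ zero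
  ... | yes p≡0 = begin
    u % N                       ≡⟨ cong (_% N) (*-identityʳ u) ⟨
    u * pos zero % N            ≡⟨ cong (λ i → u * pos i % N) p≡0 ⟨
    u * pos (σinv N u zero) % N ≡⟨ pos-σinv u⁻¹ zero ⟩
    1                           ∎
    where open ≡-Reasoning
  ... | no p≢0 = contradiction
    (oneOnlyAt-cross≤ pos-oneOnlyAt c-oneOnlyAt (p≢0 ∘ sym) (lookup A) va≤N ca≤N N+2≤2∑a)
    (<⇒≱ N<c₀*pos[p])
    where
    p : Fin (suc t)
    p = σinv N u zero
    c : Fin (suc t) → ℕ
    c i = u * pos i % N
    c-oneOnlyAt : OneOnlyAt c p
    c-oneOnlyAt = pos-σinv u⁻¹ zero , λ i i≢p → subst (2 ≤_) (pos-scale u⁻¹ i)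
      (pos≥2 λ scale≡0 → i≢p (trans (sym (σinv-scale u⁻¹ i)) (cong (σinv N u) scale≡0)))
    va≤N : pos · lookup A ≤ N
    va≤N = ≤-reflexive (trans (sym (weight≡pos·lookup A)) wA≡N)
    ca≤N : c · lookup A ≤ N
    ca≤N = ≤-reflexive (trans (sym (weight-act u⁻¹ A)) wuA≡N)
    N+2≤2∑a : N + 2 ≤ 2 * sum (lookup A)
    N+2≤2∑a = subst (λ k → N + 2 ≤ 2 * k) (deg≡sum-lookup A) N+2≤2k
    N<c₀*pos[p] : N < c zero * pos p
    N<c₀*pos[p] = m%d≡1⇒d<m
      (trans ([m%d]*n%d≡m*n%d (u * 1) (pos p))
        (trans (cong (λ r → r * pos p % N) (*-identityʳ u)) (pos-σinv u⁻¹ zero)))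
      (*-mono-≤ (proj₂ c-oneOnlyAt zero (p≢0 ∘ sym)) (s≤s z≤n))

  mult-one⇒fixed : (A : Vec ℕ (suc t)) → weight A ≡ N → N + 2 ≤ 2 * deg A →
    (g : ℕ) → IsUnit N g → mult N (act N g A) ≡ 1 → act N g A ≡ A
  mult-one⇒fixed A wA≡N N+2≤2k g (_ , _ , g⊥N) gA-mult≡1 = act-identity g g≡1 A
    where
    g⁻¹ : Invertible g
    g⁻¹ = coprime⇒invertible g⊥N
    gA∈M : InM N (act N g A)
    gA∈M = act-InM g⁻¹ A (trans (cong (_% N) wA≡N) (n%n≡0 N))
    g≡1 : g % N ≡ 1
    g≡1 = weight-act≡N⇒u≡1 g⁻¹ A wA≡N N+2≤2k (m%d≡0∧m/d≡1⇒m≡d gA∈M gA-mult≡1)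

  act-faithful : (A : Vec ℕ (suc t)) → weight A ≡ N → N + 2 ≤ 2 * deg A →
    (g h : ℕ) → IsUnit N g → IsUnit N h → act N g A ≡ act N h A → g ≡ h
  act-faithful A wA≡N N+2≤2k g h (_ , g≤ , g⊥N) (_ , h≤ , h⊥N) gA≡hA = begin
    g     ≡⟨ m<n⇒m%n≡m (s≤s g≤) ⟨
    g % N ≡⟨ invertible-cancelˡ h′⁻¹ (trans h′g≡1 (sym (Invertible.inv*u≡1 h⁻¹))) ⟩
    h % N ≡⟨ m<n⇒m%n≡m (s≤s h≤) ⟩
    h     ∎
    where
    open ≡-Reasoning
    g⁻¹ : Invertible g
    g⁻¹ = coprime⇒invertible g⊥N
    h⁻¹ : Invertible h
    h⁻¹ = coprime⇒invertible h⊥N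
    h′ : ℕ
    h′ = Invertible.inv h⁻¹
    h′⁻¹ : Invertible h′
    h′⁻¹ = inverse-invertible h⁻¹
    h′g-fixes-A : act N (h′ * g) A ≡ A
    h′g-fixes-A = begin
      act N (h′ * g) A     ≡⟨ act-∘ h′⁻¹ g⁻¹ A ⟨
      act N h′ (act N g A) ≡⟨ cong (act N h′) gA≡hA ⟩
      act N h′ (act N h A) ≡⟨ act-∘ h′⁻¹ h⁻¹ A ⟩
      act N (h′ * h) A     ≡⟨ act-identity (h′ * h) (Invertible.inv*u≡1 h⁻¹) A ⟩
      A                    ∎
    h′g≡1 : h′ * g % N ≡ 1
    h′g≡1 = weight-act≡N⇒u≡1 (invertible-* h′⁻¹ g⁻¹) A wA≡N N+2≤2k (trans (cong weight h′g-fixes-A) wA≡N)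

mainTheorem4 : (n : ℕ) .{{_ : NonZero n}} → 2 ≤ n →
    (A : Vec ℕ (n ∸ 1)) → InM n A → mult n A ≡ 1 →
    suc ⌈ n /2⌉ ≤ deg A →
    ((g : ℕ) → IsUnit n g → mult n (act n g A) ≡ 1 → act n g A ≡ A)
    × ((g h : ℕ) → IsUnit n g → IsUnit n h → act n g A ≡ act n h A → g ≡ h)
mainTheorem4 (suc (suc t)) (s≤s (s≤s z≤n)) A A∈M mult≡1 k>⌈n/2⌉ =
  mult-one⇒fixed A wA≡N N+2≤2k , act-faithful A wA≡N N+2≤2k
  where
  open Action t
  wA≡N : weight A ≡ N
  wA≡N = Modulo.m%d≡0∧m/d≡1⇒m≡d N A∈M mult≡1
  N+2≤2k : N + 2 ≤ 2 * deg A
  N+2≤2k = ⌈n/2⌉<k⇒n+2≤2k N (deg A) k>⌈n/2⌉
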